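{- Let $U$ be a finite set with $|U|=n$, and let $\mathcal{H}=(U,\mathcal{D})$ be a comatroid on $U$ with girth $p$, and set $q=n-p$. Let $f:2^U\to\mathbb{R}_+$ be supermodular and nonincreasing with $f(U)=0$. Let $\mathrm{OPT}$ be an optimal solution of $\min\{f(X): X\in\mathcal{C}\}$, where $\mathcal{C}$ is the family of all circuits of $\mathcal{H}$. Let $X_0,X_1,\dots,X_q$ and $x_1,\dots,x_q$ be produced by the greedy descent algorithm (described in the context). Then for every $i\in\{1,\dots,q\}$, $$\sum_{b\in \overline{\mathrm{OPT}}\setminus\overline{X}_{i-1}} d_{b}(X_{i-1})\;\geq\; (q-(i-1))\, d_{x_i}(X_{i-1}),$$ where $\overline{Y}=U\setminus Y$ denotes the complement (so the sum is over $b\in X_{i-1}\setminus \mathrm{OPT}$).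
   Context: A hereditary system $(U,\mathcal{D})$ consists of a finite ground set $U$ and a family $\mathcal{D}$ of subsets of $U$ (the dependent sets). It is a comatroid if the family $\{U\setminus X : X\in\mathcal{D}\}$ of complements of dependent sets is the family of independent sets of a matroid on $U$. A circuit is an inclusion-minimal member of $\mathcal{D}$, and the girth $p$ is the minimum cardinality of a circuit. For $X\subseteq U$ and $x\in X$, $d_x(X)=f(X\setminus\{x\})-f(X)$. Supermodular means $f(A\cup B)+f(A\cap B)\ge f(A)+f(B)$ for all $A,B\subseteq U$; nonincreasing means $f(A)\ge f(B)$ whenever $A\subseteq B$. Greedy descent algorithm: set $X_0=U$. For $i=1,2,\dots,q$ (with $q=n-p$): select $x_i\in X_{i-1}$ such that $d_{x_i}(X_{i-1})=\min\{d_x(X_{i-1}) : x\in X_{i-1},\ X_{i-1}\setminus\{x\}\in\mathcal{D}\}$ (ties broken arbitrarily), and set $X_i=X_{i-1}\setminus\{x_i\}$; stop after step $q$. -}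

module Defs where

open import Level using (Level; _⊔_) renaming (suc to lsuc)
open import Data.Nat using (ℕ; _<_; _≤_; pred)
open import Data.Fin using (Fin)
open import Data.Fin.Subset using (Subset; _∈_; _∉_; _⊆_; _∪_; _∩_; ⁅_⁆; ∁; ∣_∣; ⊥; ⊤) renaming (_-_ to _∖_)
open import Data.Fin.Subset.Properties using (_∈?_)
open import Data.List using (List; foldr; map; filter; allFin)
open import Data.Product using (Σ; _×_; ∃)
open import Relation.Binary.Core using (Rel)
open import Relation.Binary.Structures using (IsTotalOrder)
open import Relation.Binary.PropositionalEquality using (_≡_)
open import Algebra.Bundles using (AbelianGroup)

-- Value domain.  The paper takes f : 2^U → ℝ₊.  Only the additive
-- ordered structure of ℝ is used, so we let values live in an arbitrary
-- totally ordered abelian group (ℝ is one instance).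

record OrderedAbelianGroup (c ℓ₁ ℓ₂ : Level) : Set (lsuc (c ⊔ ℓ₁ ⊔ ℓ₂)) where
  field
    abelianGroup : AbelianGroup c ℓ₁
  open AbelianGroup abelianGroup public
  infix 4 _≤ᵍ_
  field
    _≤ᵍ_         : Rel Carrier ℓ₂
    isTotalOrder : IsTotalOrder _≈_ _≤ᵍ_
    ∙-monoˡ      : ∀ {x y} z → x ≤ᵍ y → (z ∙ x) ≤ᵍ (z ∙ y)

  _·_ : ℕ → Carrier → Carrier
  ℕ.zero  · x = ε
  ℕ.suc k · x = x ∙ (k · x)

record IsMatroid {n : ℕ} (I : Subset n → Set) : Set where
  field
    empty-indep  : I ⊥
    hereditary   : ∀ {A B} → I B → A ⊆ B → I A
    augmentation : ∀ {A B} → I A → I B → ∣ A ∣ < ∣ B ∣ →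
                   ∃ λ x → x ∈ B × x ∉ A × I (A ∪ ⁅ x ⁆)

IsComatroid : {n : ℕ} → (Subset n → Set) → Set
IsComatroid D = IsMatroid (λ Y → D (∁ Y))

IsCircuit : {n : ℕ} → (Subset n → Set) → Subset n → Set
IsCircuit D X = D X × (∀ Y → Y ⊆ X → D Y → Y ≡ X)

IsGirth : {n : ℕ} → (Subset n → Set) → ℕ → Set
IsGirth D p = (∃ λ C → IsCircuit D C × ∣ C ∣ ≡ p)
            × (∀ C → IsCircuit D C → p ≤ ∣ C ∣)

module _ {c ℓ₁ ℓ₂} (G : OrderedAbelianGroup c ℓ₁ ℓ₂) where
  open OrderedAbelianGroup G

  Supermodular : {n : ℕ} → (Subset n → Carrier) → Set ℓ₂
  Supermodular f = ∀ A B → (f A ∙ f B) ≤ᵍ (f (A ∪ B) ∙ f (A ∩ B))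

  Nonincreasing : {n : ℕ} → (Subset n → Carrier) → Set ℓ₂
  Nonincreasing f = ∀ A B → A ⊆ B → f B ≤ᵍ f A

  Nonnegative : {n : ℕ} → (Subset n → Carrier) → Set ℓ₂
  Nonnegative f = ∀ A → ε ≤ᵍ f A

  d : {n : ℕ} → (Subset n → Carrier) → Fin n → Subset n → Carrier
  d f x X = f (X ∖ x) - f X

  sumOver : {n : ℕ} → Subset n → (Fin n → Carrier) → Carrier
  sumOver {n} S g = foldr _∙_ ε (map g (filter (_∈? S) (allFin n)))

  IsOptimalCircuit : {n : ℕ} → (Subset n → Set) → (Subset n → Carrier) → Subset n → Set ℓ₂
  IsOptimalCircuit D f OPT = IsCircuit D OPT × (∀ C → IsCircuit D C → f OPT ≤ᵍ f C)

  -- X : ℕ → Subset n, x : ℕ → Fin n (indices 0..q resp. 1..q used)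
  -- form a run of the greedy descent algorithm with q steps.
  IsGreedyRun : {n : ℕ} → (Subset n → Set) → (Subset n → Carrier) → ℕ →
                (ℕ → Subset n) → (ℕ → Fin n) → Set (ℓ₂)
  IsGreedyRun D f q X x =
    (X 0 ≡ ⊤) ×
    (∀ i → 1 ≤ i → i ≤ q →
       (x i ∈ X (pred i)) ×
       D (X (pred i) ∖ x i) ×
       (∀ y → y ∈ X (pred i) → D (X (pred i) ∖ y) →
          d f (x i) (X (pred i)) ≤ᵍ d f y (X (pred i))) ×
       (X i ≡ X (pred i) ∖ x i))

-- The complement of a circuit is a basis of the matroid {U ∖ X : X ∈ D}, so
-- all circuits have the same size and |U ∖ OPT| ≥ n − p = q.  After i − 1 greedy steps the
-- complement of X_{i−1} is independent of size i − 1; augmenting it from the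
-- basis U ∖ OPT yields q − (i − 1) elements b ∈ X_{i−1} ∖ OPT for which
-- X_{i−1} ∖ {b} is still dependent.  Each such b was a candidate of the greedy
-- step, so d_b(X_{i−1}) ≥ d_{x_i}(X_{i−1}); the remaining terms of the sum are
-- nonnegative because f is nonincreasing.
module Submission where

open import Defs
open import Data.Nat using (ℕ; zero; suc; _+_; _∸_; _≤_; _<_; z≤n; s≤s; pred)
open import Data.Nat.Properties
  using (+-suc; +-identityʳ; <⇒≤; m+[n∸m]≡n; pred[n]≤n; ≤-trans; n≤1+n; ≰⇒>)
  renaming (_≤?_ to _≤ℕ?_)
open import Data.Fin using (Fin) renaming (zero to fzero; suc to fsuc)
open import Data.Fin.Subset
  using (Subset; inside; outside; ⁅_⁆; ∣_∣; ∁; _∈_; _∉_; _⊆_; _∪_; _∩_; _-_; ⊤)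
  renaming (⊥ to ∅)
open import Data.Fin.Subset.Properties
  using ( _∈?_; ∉⊥; ∣⊥∣≡0; ∪-assoc; ∪-identityʳ; p─⊥≡p; x∈p∪q⁻; x∈p∪q⁺
        ; x∈⁅y⁆⇒x≡y; x∈⁅x⁆; x∉⁅y⁆⇒x≢y; x∈p∧x≢y⇒x∈p-y; x∈∁p⇒x∉p
        ; x∉∁p⇒x∈p; x∉p⇒x∈∁p; p⊆q⇒∁p⊇∁q; ∣∁p∣≡n∸∣p∣; x∈p∩q⁺; x∈p∩q⁻; p─q⊆p; p⊆p∪q; q⊆p∪q)
open import Data.Bool.Properties using (not-involutive)
open import Data.Vec using ([]; _∷_; here; there)
open import Data.Vec.Properties using (map-∘; map-cong; map-id; map-replicate)
open import Data.List using (List; []; _∷_; length; filter; foldr; tabulate; allFin)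
import Data.List as List
open import Data.Product using (∃; _×_; _,_; proj₁; proj₂)
open import Data.Sum using (inj₁; inj₂)
open import Data.Empty using (⊥-elim)
open import Relation.Nullary using (¬_; yes; no)
open import Relation.Binary.PropositionalEquality using (_≡_; refl; sym; trans; cong; subst; module ≡-Reasoning)
open import Relation.Binary.Structures using (IsTotalOrder)
open import Function using (_∘_; id)

private
  variable
    n : ℕ

∁-involutive : (p : Subset n) → ∁ (∁ p) ≡ p
∁-involutive p = trans (sym (map-∘ _ _ p)) (trans (map-cong not-involutive p) (map-id p))

∁⊤≡⊥ : ∀ n → ∁ (⊤ {n}) ≡ ∅
∁⊤≡⊥ n = map-replicate _ inside n

∁⊥≡⊤ : ∀ n → ∁ (∅ {n}) ≡ ⊤
∁⊥≡⊤ n = map-replicate _ outside n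

∣p∪⁅x⁆∣≡1+∣p∣ : (p : Subset n) (x : Fin n) → x ∉ p → ∣ p ∪ ⁅ x ⁆ ∣ ≡ suc ∣ p ∣
∣p∪⁅x⁆∣≡1+∣p∣ (inside  ∷ p) fzero    x∉p = ⊥-elim (x∉p here)
∣p∪⁅x⁆∣≡1+∣p∣ (outside ∷ p) fzero    x∉p = cong (suc ∘ ∣_∣) (∪-identityʳ p)
∣p∪⁅x⁆∣≡1+∣p∣ (inside  ∷ p) (fsuc x) x∉p = cong suc (∣p∪⁅x⁆∣≡1+∣p∣ p x (x∉p ∘ there))
∣p∪⁅x⁆∣≡1+∣p∣ (outside ∷ p) (fsuc x) x∉p = ∣p∪⁅x⁆∣≡1+∣p∣ p x (x∉p ∘ there)

∣∁[p-x]∣≡1+∣∁p∣ : (p : Subset n) (x : Fin n) → x ∈ p → ∣ ∁ (p - x) ∣ ≡ suc ∣ ∁ p ∣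
∣∁[p-x]∣≡1+∣∁p∣ (inside ∷ p) fzero    here        = cong (suc ∘ ∣_∣ ∘ ∁) (p─⊥≡p p)
∣∁[p-x]∣≡1+∣∁p∣ (inside ∷ p) (fsuc x) (there x∈p) = ∣∁[p-x]∣≡1+∣∁p∣ p x x∈p
∣∁[p-x]∣≡1+∣∁p∣ (outside ∷ p) (fsuc x) (there x∈p) = cong suc (∣∁[p-x]∣≡1+∣∁p∣ p x x∈p)

p∪⁅x⁆⊆q : {p q : Subset n} {x : Fin n} → p ⊆ q → x ∈ q → p ∪ ⁅ x ⁆ ⊆ q
p∪⁅x⁆⊆q {p = p} {x = x} p⊆q x∈q y∈p∪x with x∈p∪q⁻ p ⁅ x ⁆ y∈p∪x
... | inj₁ y∈p = p⊆q y∈p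
... | inj₂ y∈x = subst (_∈ _) (sym (x∈⁅y⁆⇒x≡y x y∈x)) x∈q

∁[∁p∪⁅x⁆]⊆p-x : (p : Subset n) (x : Fin n) → ∁ (∁ p ∪ ⁅ x ⁆) ⊆ p - x
∁[∁p∪⁅x⁆]⊆p-x p x y∈ =
  x∈p∧x≢y⇒x∈p-y (x∉∁p⇒x∈p (x∈∁p⇒x∉p y∈ ∘ x∈p∪q⁺ ∘ inj₁))
                (x∉⁅y⁆⇒x≢y (x∈∁p⇒x∉p y∈ ∘ x∈p∪q⁺ ∘ inj₂))

count : Subset n → List (Fin n) → ℕ
count S = length ∘ filter (_∈? S)

count-tabulate-suc : ∀ {m} s (S : Subset n) (g : Fin m → Fin n) →
                     count (s ∷ S) (tabulate (fsuc ∘ g)) ≡ count S (tabulate g)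
count-tabulate-suc {m = zero}  s S g = refl
count-tabulate-suc {m = suc m} s S g with g fzero ∈? S
... | yes _ = cong suc (count-tabulate-suc s S (g ∘ fsuc))
... | no  _ = count-tabulate-suc s S (g ∘ fsuc)

count-allFin : (S : Subset n) → count S (allFin n) ≡ ∣ S ∣
count-allFin []            = refl
count-allFin (inside  ∷ S) = cong suc (trans (count-tabulate-suc inside S id) (count-allFin S))
count-allFin (outside ∷ S) = trans (count-tabulate-suc outside S id) (count-allFin S)

module _ {c ℓ₁ ℓ₂} (G : OrderedAbelianGroup c ℓ₁ ℓ₂) where
  open OrderedAbelianGroup G
    using (Carrier; _∙_; ε; _⁻¹; _≤ᵍ_; _·_; ∙-monoˡ; comm; inverseʳ; identityˡ; isTotalOrder)
  private module ≤ = IsTotalOrder isTotalOrder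

  ∙-monoʳ : ∀ {a b} z → a ≤ᵍ b → (a ∙ z) ≤ᵍ (b ∙ z)
  ∙-monoʳ {a} {b} z a≤b = ≤.≲-respʳ-≈ (comm z b) (≤.≲-respˡ-≈ (comm z a) (∙-monoˡ z a≤b))

  ∙-mono : ∀ {a b a′ b′} → a ≤ᵍ b → a′ ≤ᵍ b′ → (a ∙ a′) ≤ᵍ (b ∙ b′)
  ∙-mono {b = b} a≤b a′≤b′ = ≤.trans (∙-monoʳ _ a≤b) (∙-monoˡ b a′≤b′)

  ε≤d : {f : Subset n → Carrier} → Nonincreasing G f → ∀ b X → ε ≤ᵍ d G f b X
  ε≤d {f = f} f↓ b X = ≤.≲-respˡ-≈ (inverseʳ (f X)) (∙-monoʳ (f X ⁻¹) (f↓ (X - b) X (p─q⊆p X ⁅ b ⁆)))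

  module _ {S T : Subset n} {g : Fin n → Carrier} {a : Carrier} (S⊆T : S ⊆ T)
           (g≥ε : ∀ {b} → b ∈ T → ε ≤ᵍ g b) (g≥a : ∀ {b} → b ∈ S → a ≤ᵍ g b) where

    count·≤sum : ∀ L → (count S L · a) ≤ᵍ foldr _∙_ ε (List.map g (filter (_∈? T) L))
    count·≤sum [] = ≤.refl
    count·≤sum (b ∷ L) with b ∈? T | b ∈? S
    ... | yes _   | yes b∈S = ∙-mono (g≥a b∈S) (count·≤sum L)
    ... | yes b∈T | no  _   = ≤.≲-respˡ-≈ (identityˡ _) (∙-mono (g≥ε b∈T) (count·≤sum L))
    ... | no  b∉T | yes b∈S = ⊥-elim (b∉T (S⊆T b∈S))
    ... | no  _   | no  _   = count·≤sum L

    ∣S∣·≤sumOver : (∣ S ∣ · a) ≤ᵍ sumOver G T g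
    ∣S∣·≤sumOver = subst (λ k → (k · a) ≤ᵍ sumOver G T g) (count-allFin S) (count·≤sum (allFin n))

module MatroidProperties {I : Subset n → Set} (M : IsMatroid I) where
  open IsMatroid M
  open ≡-Reasoning

  record Extension (A B : Subset n) (k : ℕ) : Set where
    field
      S           : Subset n
      S⊆B         : S ⊆ B
      S⊆∁A        : S ⊆ ∁ A
      ∣S∣≡k        : ∣ S ∣ ≡ k
      ∣A∪S∣≡∣A∣+k   : ∣ A ∪ S ∣ ≡ ∣ A ∣ + k
      independent : I (A ∪ S)

  extend-step : ∀ {A B k} → I B → Extension A B k → ∣ A ∣ + k < ∣ B ∣ → Extension A B (suc k)
  extend-step {A} {B} {k} IB e ∣A∣+k<∣B∣ =
    grow (augmentation independent IB (subst (_< ∣ B ∣) (sym ∣A∪S∣≡∣A∣+k) ∣A∣+k<∣B∣))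
    where
    open Extension e
    grow : (∃ λ y → y ∈ B × y ∉ A ∪ S × I ((A ∪ S) ∪ ⁅ y ⁆)) → Extension A B (suc k)
    grow (y , y∈B , y∉A∪S , I[A∪S∪y]) = record
      { S           = S ∪ ⁅ y ⁆
      ; S⊆B         = p∪⁅x⁆⊆q S⊆B y∈B
      ; S⊆∁A        = p∪⁅x⁆⊆q S⊆∁A (x∉p⇒x∈∁p (y∉A∪S ∘ p⊆p∪q S))
      ; ∣S∣≡k        = trans (∣p∪⁅x⁆∣≡1+∣p∣ S y (y∉A∪S ∘ q⊆p∪q A S)) (cong suc ∣S∣≡k)
      ; ∣A∪S∣≡∣A∣+k   = begin
          ∣ A ∪ (S ∪ ⁅ y ⁆) ∣ ≡⟨ cong ∣_∣ (sym (∪-assoc A S ⁅ y ⁆)) ⟩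
          ∣ (A ∪ S) ∪ ⁅ y ⁆ ∣ ≡⟨ ∣p∪⁅x⁆∣≡1+∣p∣ (A ∪ S) y y∉A∪S ⟩
          suc ∣ A ∪ S ∣       ≡⟨ cong suc ∣A∪S∣≡∣A∣+k ⟩
          suc (∣ A ∣ + k)     ≡⟨ sym (+-suc ∣ A ∣ k) ⟩
          ∣ A ∣ + suc k       ∎
      ; independent = subst I (∪-assoc A S ⁅ y ⁆) I[A∪S∪y]
      }

  extend : ∀ {A B} → I A → I B → ∀ k → ∣ A ∣ + k ≤ ∣ B ∣ → Extension A B k
  extend {A} IA IB zero _ = record
    { S           = ∅
    ; S⊆B         = ⊥-elim ∘ ∉⊥
    ; S⊆∁A        = ⊥-elim ∘ ∉⊥
    ; ∣S∣≡k        = ∣⊥∣≡0 n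
    ; ∣A∪S∣≡∣A∣+k   = trans (cong ∣_∣ (∪-identityʳ A)) (sym (+-identityʳ ∣ A ∣))
    ; independent = subst I (sym (∪-identityʳ A)) IA
    }
  extend {A} {B} IA IB (suc k) ∣A∣+1+k≤∣B∣ =
    extend-step IB (extend IA IB k (<⇒≤ ∣A∣+k<∣B∣)) ∣A∣+k<∣B∣
    where
    ∣A∣+k<∣B∣ : ∣ A ∣ + k < ∣ B ∣
    ∣A∣+k<∣B∣ = subst (_≤ ∣ B ∣) (+-suc ∣ A ∣ k) ∣A∣+1+k≤∣B∣

module ComatroidProperties {D : Subset n → Set} (comatroid : IsComatroid D) where
  open IsMatroid comatroid
  open MatroidProperties comatroid

  ∁-independent : ∀ {X} → D X → D (∁ (∁ X))
  ∁-independent {X} = subst D (sym (∁-involutive X))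

  dependent-upward : ∀ {Y Z} → D Y → Y ⊆ Z → D Z
  dependent-upward {Y} {Z} DY Y⊆Z =
    subst D (∁-involutive Z) (hereditary (∁-independent DY) (p⊆q⇒∁p⊇∁q Y⊆Z))

  ⊤-dependent : D ⊤
  ⊤-dependent = subst D (∁⊥≡⊤ n) empty-indep

  ∁circuit-maximal : ∀ {C y} → IsCircuit D C → y ∈ C → ¬ D (∁ (∁ C ∪ ⁅ y ⁆))
  ∁circuit-maximal {C} {y} (_ , C-minimal) y∈C D[C-y] =
    x∈∁p⇒x∉p (subst (y ∈_) (sym C-y≡C) y∈C) (x∈p∪q⁺ (inj₂ (x∈⁅x⁆ y)))
    where
    C-y≡C : ∁ (∁ C ∪ ⁅ y ⁆) ≡ C
    C-y≡C = C-minimal _ (λ z∈ → x∉∁p⇒x∈p (x∈∁p⇒x∉p z∈ ∘ x∈p∪q⁺ ∘ inj₁)) D[C-y]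

  ∣∁C∣≤∣∁C′∣ : ∀ {C C′} → IsCircuit D C → IsCircuit D C′ → ∣ ∁ C ∣ ≤ ∣ ∁ C′ ∣
  ∣∁C∣≤∣∁C′∣ {C} {C′} C-circuit C′-circuit with ∣ ∁ C ∣ ≤ℕ? ∣ ∁ C′ ∣
  ... | yes ∣∁C∣≤∣∁C′∣ = ∣∁C∣≤∣∁C′∣
  ... | no  ∣∁C∣≰∣∁C′∣
    with augmentation (∁-independent (proj₁ C′-circuit)) (∁-independent (proj₁ C-circuit))
                      (≰⇒> ∣∁C∣≰∣∁C′∣)
  ... | y , _ , y∉∁C′ , I[∁C′∪y] = ⊥-elim (∁circuit-maximal C′-circuit (x∉∁p⇒x∈p y∉∁C′) I[∁C′∪y])

  n∸girth≤∣∁C∣ : ∀ {p C} → IsGirth D p → IsCircuit D C → n ∸ p ≤ ∣ ∁ C ∣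
  n∸girth≤∣∁C∣ ((C₀ , C₀-circuit , ∣C₀∣≡p) , _) C-circuit =
    subst (_≤ _) (trans (∣∁p∣≡n∸∣p∣ C₀) (cong (n ∸_) ∣C₀∣≡p)) (∣∁C∣≤∣∁C′∣ C₀-circuit C-circuit)

  record DeletableSubset (Y Z : Subset n) (k : ℕ) : Set where
    field
      S         : Subset n
      S⊆Y∩∁Z    : S ⊆ Y ∩ ∁ Z
      ∣S∣≡k      : ∣ S ∣ ≡ k
      deletable : ∀ {b} → b ∈ S → D (Y - b)

  deletable-subset : ∀ {Y Z} → D Y → D Z → ∀ k → ∣ ∁ Y ∣ + k ≤ ∣ ∁ Z ∣ → DeletableSubset Y Z k
  deletable-subset {Y} {Z} DY DZ k room = record
    { S         = S
    ; S⊆Y∩∁Z    = λ b∈S → x∈p∩q⁺ (x∉∁p⇒x∈p (x∈∁p⇒x∉p (S⊆∁A b∈S)) , S⊆B b∈S)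
    ; ∣S∣≡k      = ∣S∣≡k
    ; deletable = λ {b} b∈S → dependent-upward
        (hereditary independent (p∪⁅x⁆⊆q (p⊆p∪q S) (q⊆p∪q (∁ Y) S b∈S)))
        (∁[∁p∪⁅x⁆]⊆p-x Y b)
    }
    where open Extension (extend (∁-independent DY) (∁-independent DZ) k room)

module GreedyRun {c ℓ₁ ℓ₂} {G : OrderedAbelianGroup c ℓ₁ ℓ₂} {D : Subset n → Set}
                 {f : Subset n → OrderedAbelianGroup.Carrier G} {q : ℕ}
                 {X : ℕ → Subset n} {x : ℕ → Fin n} (run : IsGreedyRun G D f q X x) where
  open OrderedAbelianGroup G using (_≤ᵍ_)

  X-dependent : IsComatroid D → ∀ j → j ≤ q → D (X j)
  X-dependent comatroid zero _ =
    subst D (sym (proj₁ run)) (ComatroidProperties.⊤-dependent {D = D} comatroid)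
  X-dependent comatroid (suc j) 1+j≤q with proj₂ run (suc j) (s≤s z≤n) 1+j≤q
  ... | _ , D[X-x] , _ , X≡X-x = subst D (sym X≡X-x) D[X-x]

  ∣∁X∣≡ : ∀ j → j ≤ q → ∣ ∁ (X j) ∣ ≡ j
  ∣∁X∣≡ zero    _     = trans (cong (∣_∣ ∘ ∁) (proj₁ run)) (trans (cong ∣_∣ (∁⊤≡⊥ n)) (∣⊥∣≡0 n))
  ∣∁X∣≡ (suc j) 1+j≤q with proj₂ run (suc j) (s≤s z≤n) 1+j≤q
  ... | x∈X , _ , _ , X≡X-x = begin
    ∣ ∁ (X (suc j)) ∣      ≡⟨ cong (∣_∣ ∘ ∁) X≡X-x ⟩
    ∣ ∁ (X j - x (suc j)) ∣ ≡⟨ ∣∁[p-x]∣≡1+∣∁p∣ (X j) (x (suc j)) x∈X ⟩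
    suc ∣ ∁ (X j) ∣        ≡⟨ cong suc (∣∁X∣≡ j (≤-trans (n≤1+n j) 1+j≤q)) ⟩
    suc j                 ∎
    where open ≡-Reasoning

  greedy-minimal : ∀ i → 1 ≤ i → i ≤ q → ∀ {b} → b ∈ X (pred i) → D (X (pred i) - b) →
                   d G f (x i) (X (pred i)) ≤ᵍ d G f b (X (pred i))
  greedy-minimal i 1≤i i≤q {b} = proj₁ (proj₂ (proj₂ (proj₂ run i 1≤i i≤q))) b

mainTheorem1 : ∀ {c ℓ₁ ℓ₂} (G : OrderedAbelianGroup c ℓ₁ ℓ₂) →
    let open OrderedAbelianGroup G in
    (n : ℕ) (D : Subset n → Set) → IsComatroid D →
    (p : ℕ) → IsGirth D p →
    (f : Subset n → Carrier) → Nonnegative G f → Supermodular G f →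
    Nonincreasing G f → f ⊤ ≈ ε →
    (OPT : Subset n) → IsOptimalCircuit G D f OPT →
    (X : ℕ → Subset n) (x : ℕ → Fin n) → IsGreedyRun G D f (n ∸ p) X x →
    ∀ i → 1 ≤ i → i ≤ n ∸ p →
    ((n ∸ p ∸ pred i) · d G f (x i) (X (pred i)))
      ≤ᵍ sumOver G (X (pred i) ∩ ∁ OPT) (λ b → d G f b (X (pred i)))
mainTheorem1 G n D comatroid p girth f _ _ f↓ _ OPT (OPT-circuit , _) X x run i 1≤i i≤q =
  subst (λ k → (k · d G f (x i) Y) ≤ᵍ sumOver G (Y ∩ ∁ OPT) (λ b → d G f b Y)) ∣S∣≡k
    (∣S∣·≤sumOver G S⊆Y∩∁Z (λ _ → ε≤d G f↓ _ Y)
       (λ b∈S → greedy-minimal i 1≤i i≤q (proj₁ (x∈p∩q⁻ Y (∁ OPT) (S⊆Y∩∁Z b∈S))) (deletable b∈S)))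
  where
  open OrderedAbelianGroup G using (_·_; _≤ᵍ_)
  open ComatroidProperties {D = D} comatroid
  open GreedyRun {G = G} {D = D} {f = f} run
  Y : Subset n
  Y = X (pred i)
  j≤q : pred i ≤ n ∸ p
  j≤q = ≤-trans pred[n]≤n i≤q
  room : ∣ ∁ Y ∣ + (n ∸ p ∸ pred i) ≤ ∣ ∁ OPT ∣
  room = subst (_≤ ∣ ∁ OPT ∣) (sym (trans (cong (_+ _) (∣∁X∣≡ (pred i) j≤q)) (m+[n∸m]≡n j≤q)))
               (n∸girth≤∣∁C∣ girth OPT-circuit)
  open DeletableSubset (deletable-subset (X-dependent comatroid (pred i) j≤q) (proj₁ OPT-circuit) _ room)
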